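{- Let $\mathbf{a}=(a_1,\ldots,a_n) \in \mathsf{Asc}_n$ and $M=f_{\mathsf{AM}}(\mathbf{a})$ with $\dim(M)=d$. There will be a zero on the diagonal of $M$ if and only if there exists $i\in [1,n-1]$ such that $a_i<a_{i+1}\leq \mathsf{asc}(a_1,\ldots,a_i)$.
   Context: An ascent sequence is a sequence $(a_1,\ldots,a_n)$ of non-negative integers with $a_1=0$ and $a_i\le \mathsf{asc}(a_1,\ldots,a_{i-1})+1$ for $1<i\le n$, where $\mathsf{asc}$ counts positions $j$ with $a_j<a_{j+1}$; $\mathsf{Asc}_n$ is the set of these. For a matrix $M$, $\mathsf{mindex}(M)$ is the lowest index of a row whose rightmost entry is non-zero. The map $f_{\mathsf{AM}}$ (a bijection onto upper-triangular non-negative integer matrices with entries summing to $n$ and no zero rows or columns) is defined recursively: $M^{(1)}=(1)$, and given $M^{(k)}$: (AM1) if $a_{k+1}\in[0,\mathsf{mindex}(M^{(k)}))$, increase the entry at $(a_{k+1}+1,\dim(M^{(k)}))$ by one; (AM2) if $a_{k+1}=\dim(M^{(k)})$, append a new row and column of zeros and put a $1$ in the new diagonal entry; (AM3) if $a_{k+1}\in[\mathsf{mindex}(M^{(k)}),\dim(M^{(k)}))$, insert a new row between rows $a_{k+1}$ and $a_{k+1}+1$ and a new column between columns $a_{k+1}$ and $a_{k+1}+1$, fill the new row with zeros except a $1$ in its rightmost entry, move the entries of the rightmost column lying above the new row into the new column (same rows), replacing them by zeros, and fill the rest of the new column with zeros. Then $f_{\mathsf{AM}}(\mathbf{a})=M^{(n)}$.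 -}

module Defs where

open import Data.Nat using (ℕ; zero; suc; _+_; _≤_; _<_; _<?_; _≤?_; _≟_)
open import Data.List using (List; []; _∷_; _++_; [_]; length; map; take; drop; replicate; foldl)
open import Data.Product using (Σ; _×_)
open import Data.Empty using (⊥)
open import Relation.Nullary using (yes; no)
open import Relation.Binary.PropositionalEquality using (_≡_)

-- i-th entry (0-based) of a list of naturals, 0 if out of range
get0 : List ℕ → ℕ → ℕ
get0 []       _       = 0
get0 (x ∷ xs) zero    = x
get0 (x ∷ xs) (suc i) = get0 xs i

ascFrom : ℕ → List ℕ → ℕ
ascFrom x []      = 0
ascFrom x (y ∷ r) with x <? y
... | yes _ = suc (ascFrom y r)
... | no  _ = ascFrom y r

asc : List ℕ → ℕ
asc []      = 0
asc (x ∷ r) = ascFrom x r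

-- (a_1,…,a_n) is an ascent sequence (list index i is 0-based: entry i = a_{i+1})
IsAscent : List ℕ → Set
IsAscent []       = ⊥
IsAscent (x ∷ xs) =
  x ≡ 0 × (∀ i → suc i < length (x ∷ xs) →
             get0 (x ∷ xs) (suc i) ≤ suc (asc (take (suc i) (x ∷ xs))))

-- Matrices: list of rows (each row a list of naturals of length dim)
Matrix : Set
Matrix = List (List ℕ)

dim : Matrix → ℕ
dim = length

getRow : Matrix → ℕ → List ℕ
getRow []       _       = []
getRow (r ∷ rs) zero    = r
getRow (r ∷ rs) (suc i) = getRow rs i

entry : Matrix → ℕ → ℕ → ℕ   -- 0-based row, column
entry M i j = get0 (getRow M i) j

lastEntry : List ℕ → ℕ
lastEntry []           = 0
lastEntry (x ∷ [])     = x
lastEntry (x ∷ y ∷ r)  = lastEntry (y ∷ r)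

incLast : List ℕ → List ℕ
incLast []          = []
incLast (x ∷ [])    = suc x ∷ []
incLast (x ∷ y ∷ r) = x ∷ incLast (y ∷ r)

zeroLast : List ℕ → List ℕ
zeroLast []          = []
zeroLast (x ∷ [])    = 0 ∷ []
zeroLast (x ∷ y ∷ r) = x ∷ zeroLast (y ∷ r)

-- 0-based index of the first row whose rightmost entry is non-zero
-- (so mindex(M) = mindex0 M + 1); length M if there is none
mindex0 : Matrix → ℕ
mindex0 []       = 0
mindex0 (r ∷ rs) with lastEntry r ≟ 0
... | yes _ = suc (mindex0 rs)
... | no  _ = 0

updateRow : ℕ → (List ℕ → List ℕ) → Matrix → Matrix
updateRow _       f []       = []
updateRow zero    f (r ∷ rs) = f r ∷ rs
updateRow (suc i) f (r ∷ rs) = r ∷ updateRow i f rs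

am2 : Matrix → Matrix
am2 M = map (λ r → r ++ [ 0 ]) M ++ [ replicate (dim M) 0 ++ [ 1 ] ]

am3rows : ℕ → ℕ → ℕ → Matrix → Matrix
am3rows a d i [] = []
am3rows a d i (r ∷ rs) with i <? a
... | yes _ = (take a r ++ [ lastEntry r ] ++ zeroLast (drop a r)) ∷ am3rows a d (suc i) rs
... | no  _ = (take a r ++ [ 0 ] ++ drop a r) ∷ am3rows a d (suc i) rs

am3 : ℕ → Matrix → Matrix
am3 a M = take a rows ++ [ replicate (dim M) 0 ++ [ 1 ] ] ++ drop a rows
  where rows = am3rows a (dim M) 0 M

step : Matrix → ℕ → Matrix
step M a with a ≟ dim M
... | yes _ = am2 M
... | no  _ with a ≤? mindex0 M
...   | yes _ = updateRow a incLast M          -- (AM1): a ∈ [0, mindex(M))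
...   | no  _ with a <? dim M
...     | yes _ = am3 a M                       -- (AM3): a ∈ [mindex(M), dim M)
...     | no  _ = M                             -- unreachable for ascent sequences

fAM : List ℕ → Matrix
fAM []       = []
fAM (x ∷ xs) = foldl step ((1 ∷ []) ∷ []) xs

HasDiagZero : Matrix → Set
HasDiagZero M = Σ ℕ (λ i → i < dim M × entry M i i ≡ 0)

module Submission where

-- Reading an ascent sequence, f_AM keeps a square matrix of dimension c + 1, where c is the
-- number of ascents read so far, whose mindex row is the row of the last entry x read
-- (0-based: mindex0 M = x).  So the next entry y is an (AM1) step when y ≤ x, an (AM2) step
-- when y = c + 1, and an (AM3) step exactly when x < y ≤ c.  (AM1) only increments an entry
-- of the last column, which is on the diagonal only in the mindex row, where it is already
-- non-zero, and (AM2) adds a diagonal 1; neither creates nor destroys a diagonal zero.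
-- (AM3) always creates one: the new row y has its only non-zero entry in the last column,
-- not at (y, y).  Hence a diagonal zero exists exactly when some step is of type (AM3).

open import Defs
open import Data.Nat using (ℕ; zero; suc; _+_; _<_; _≤_; z≤n; s≤s; _<?_; _≤?_; _≟_)
open import Data.Nat.Properties
open import Data.List using (List; []; _∷_; _++_; [_]; length; map; take; drop; replicate; foldl)
open import Data.List.Properties using (length-++; length-map; length-take)
open import Data.List.Relation.Unary.All using (All; []; _∷_)
import Data.List.Relation.Unary.All as All
import Data.List.Relation.Unary.All.Properties as AllP
open import Data.Product using (Σ; _×_; _,_; proj₁; proj₂)
open import Data.Sum using (_⊎_; inj₁; inj₂; [_,_]′)
open import Data.Sum.Algebra using (⊎-assoc)
open import Data.Sum.Function.Propositional using (_⊎-⇔_)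
open import Data.Empty using (⊥; ⊥-elim)
open import Function.Base using (_∘_; id)
open import Function.Bundles using (_⇔_; mk⇔; Equivalence)
open import Function.Construct.Identity using (⇔-id)
open import Function.Construct.Symmetry using (⇔-sym)
open import Function.Related.Propositional using (module EquationalReasoning)
open import Level using (0ℓ)
open import Relation.Nullary using (¬_; yes; no)
open import Relation.Binary.PropositionalEquality hiding ([_])

open Equivalence using (to; from)

unitRow : ℕ → List ℕ
unitRow d = replicate d 0 ++ [ 1 ]

length-unitRow : ∀ d → length (unitRow d) ≡ suc d
length-unitRow zero    = refl
length-unitRow (suc d) = cong suc (length-unitRow d)

get0-unitRow-< : ∀ {d y} → y < d → get0 (unitRow d) y ≡ 0
get0-unitRow-< {suc d} {zero}  _         = refl
get0-unitRow-< {suc d} {suc y} (s≤s y<d) = get0-unitRow-< y<d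

get0-unitRow-last : ∀ d → get0 (unitRow d) d ≡ 1
get0-unitRow-last zero    = refl
get0-unitRow-last (suc d) = get0-unitRow-last d

-- also at j = length r, as get0 is 0 out of range
get0-∷ʳ0 : ∀ r j → get0 (r ++ [ 0 ]) j ≡ get0 r j
get0-∷ʳ0 []      zero    = refl
get0-∷ʳ0 []      (suc j) = refl
get0-∷ʳ0 (x ∷ r) zero    = refl
get0-∷ʳ0 (x ∷ r) (suc j) = get0-∷ʳ0 r j

get0-lastIndex : ∀ r c → length r ≡ suc c → get0 r c ≡ lastEntry r
get0-lastIndex (x ∷ [])    zero    _  = refl
get0-lastIndex (x ∷ y ∷ r) (suc c) eq = get0-lastIndex (y ∷ r) c (suc-injective eq)

lastEntry-++-∷ : ∀ xs y ys → lastEntry (xs ++ y ∷ ys) ≡ lastEntry (y ∷ ys)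
lastEntry-++-∷ []            y ys = refl
lastEntry-++-∷ (x ∷ [])      y ys = refl
lastEntry-++-∷ (x ∷ x′ ∷ xs) y ys = lastEntry-++-∷ (x′ ∷ xs) y ys

lastEntry-∷ʳ : ∀ xs v → lastEntry (xs ++ [ v ]) ≡ v
lastEntry-∷ʳ xs v = lastEntry-++-∷ xs v []

lastEntry-unitRow : ∀ d → lastEntry (unitRow d) ≡ 1
lastEntry-unitRow d = lastEntry-∷ʳ (replicate d 0) 1

lastEntry-∷-zeroLast : ∀ v z zs → lastEntry (v ∷ zeroLast (z ∷ zs)) ≡ 0
lastEntry-∷-zeroLast v z []       = refl
lastEntry-∷-zeroLast v z (w ∷ ws) = lastEntry-∷-zeroLast z w ws

lastEntry-∷-zeroLast-drop : ∀ a r v → a < length r → lastEntry (v ∷ zeroLast (drop a r)) ≡ 0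
lastEntry-∷-zeroLast-drop zero    (z ∷ zs) v _        = lastEntry-∷-zeroLast v z zs
lastEntry-∷-zeroLast-drop (suc a) (_ ∷ r)  v (s≤s a<) = lastEntry-∷-zeroLast-drop a r v a<

length-zeroLast : ∀ r → length (zeroLast r) ≡ length r
length-zeroLast []          = refl
length-zeroLast (x ∷ [])    = refl
length-zeroLast (x ∷ y ∷ r) = cong suc (length-zeroLast (y ∷ r))

length-incLast : ∀ r → length (incLast r) ≡ length r
length-incLast []          = refl
length-incLast (x ∷ [])    = refl
length-incLast (x ∷ y ∷ r) = cong suc (length-incLast (y ∷ r))

get0-incLast-< : ∀ r j → suc j < length r → get0 (incLast r) j ≡ get0 r j
get0-incLast-< (x ∷ [])    _       (s≤s ())
get0-incLast-< (x ∷ y ∷ r) zero    _        = refl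
get0-incLast-< (x ∷ y ∷ r) (suc j) (s≤s j<) = get0-incLast-< (y ∷ r) j j<

get0-incLast-lastIndex : ∀ r c → length r ≡ suc c → get0 (incLast r) c ≡ suc (lastEntry r)
get0-incLast-lastIndex (x ∷ [])    zero    _  = refl
get0-incLast-lastIndex (x ∷ y ∷ r) (suc c) eq = get0-incLast-lastIndex (y ∷ r) c (suc-injective eq)

lastEntry-incLast : ∀ r → 0 < length r → lastEntry (incLast r) ≡ suc (lastEntry r)
lastEntry-incLast (x ∷ [])        _ = refl
lastEntry-incLast (x ∷ y ∷ [])    _ = refl
lastEntry-incLast (x ∷ y ∷ z ∷ r) _ = lastEntry-incLast (y ∷ z ∷ r) (s≤s z≤n)

length-take-≤ : ∀ {A : Set} n (xs : List A) → n ≤ length xs → length (take n xs) ≡ n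
length-take-≤ n xs n≤ = trans (length-take n xs) (m≤n⇒m⊓n≡m n≤)

length-take-++-∷ : ∀ {A : Set} n (xs : List A) x ys → length ys ≡ length (drop n xs) →
                   length (take n xs ++ x ∷ ys) ≡ suc (length xs)
length-take-++-∷ zero    xs       x ys eq = cong suc eq
length-take-++-∷ (suc n) []       x ys eq = cong suc eq
length-take-++-∷ (suc n) (y ∷ xs) x ys eq = cong suc (length-take-++-∷ n xs x ys eq)

padRows : Matrix → Matrix
padRows = map (λ r → r ++ [ 0 ])

All-getRow : ∀ {P : List ℕ → Set} {M y} → All P M → y < length M → P (getRow M y)
All-getRow {y = zero}  (p ∷ _)  _         = p
All-getRow {y = suc y} (_ ∷ ps) (s≤s y<) = All-getRow ps y<

length-updateRow : ∀ y f M → length (updateRow y f M) ≡ length M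
length-updateRow y       f []      = refl
length-updateRow zero    f (r ∷ M) = refl
length-updateRow (suc y) f (r ∷ M) = cong suc (length-updateRow y f M)

All-updateRow : ∀ {P : List ℕ → Set} y f {M} → (∀ {r} → P r → P (f r)) → All P M →
                All P (updateRow y f M)
All-updateRow y       f Pf []       = []
All-updateRow zero    f Pf (p ∷ ps) = Pf p ∷ ps
All-updateRow (suc y) f Pf (p ∷ ps) = p ∷ All-updateRow y f Pf ps

mindex0-lastEntry≢0 : ∀ M → mindex0 M < length M → lastEntry (getRow M (mindex0 M)) ≢ 0
mindex0-lastEntry≢0 (r ∷ rs) lt with lastEntry r ≟ 0
... | yes _  = mindex0-lastEntry≢0 rs (≤-pred lt)
... | no  ≢0 = ≢0

mindex0-∷ : ∀ r rs {k} → lastEntry r ≡ suc k → mindex0 (r ∷ rs) ≡ 0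
mindex0-∷ r rs eq with lastEntry r ≟ 0
... | yes eq′ = ⊥-elim (1+n≢0 (trans (sym eq) eq′))
... | no  _   = refl

mindex0-++ : ∀ A B → All (λ r → lastEntry r ≡ 0) A → mindex0 (A ++ B) ≡ length A + mindex0 B
mindex0-++ []      B []       = refl
mindex0-++ (r ∷ A) B (p ∷ ps) with lastEntry r ≟ 0
... | yes _  = cong suc (mindex0-++ A B ps)
... | no  ≢0 = ⊥-elim (≢0 p)

mindex0-updateRow-incLast : ∀ y M → y ≤ mindex0 M → y < length M →
                            All (λ r → 0 < length r) M → mindex0 (updateRow y incLast M) ≡ y
mindex0-updateRow-incLast zero    (r ∷ rs) _ _ (p ∷ _) =
  mindex0-∷ (incLast r) rs (lastEntry-incLast r p)
mindex0-updateRow-incLast (suc y) (r ∷ rs) y≤ (s≤s y<) (_ ∷ ps) with lastEntry r ≟ 0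
... | yes _ = cong suc (mindex0-updateRow-incLast y rs (≤-pred y≤) y< ps)
mindex0-updateRow-incLast (suc y) (r ∷ rs) () _ _ | no _

-- some entry (i, k + i) of M is zero
SuperdiagZero : ℕ → Matrix → Set
SuperdiagZero k []       = ⊥
SuperdiagZero k (r ∷ rs) = get0 r k ≡ 0 ⊎ SuperdiagZero (suc k) rs

HasDiagZero⇔SuperdiagZero : ∀ M → HasDiagZero M ⇔ SuperdiagZero 0 M
HasDiagZero⇔SuperdiagZero = shifted 0
  where
  shifted : ∀ k M → (Σ ℕ λ i → i < length M × entry M i (k + i) ≡ 0) ⇔ SuperdiagZero k M
  shifted k []       = mk⇔ (λ { (_ , () , _) }) (λ ())
  shifted k (r ∷ rs) = mk⇔ toS fromS
    where
    toS : (Σ ℕ λ i → i < length (r ∷ rs) × entry (r ∷ rs) i (k + i) ≡ 0) →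
          SuperdiagZero k (r ∷ rs)
    toS (zero  , _      , e) = inj₁ (subst (λ t → get0 r t ≡ 0) (+-identityʳ k) e)
    toS (suc i , s≤s i< , e) =
      inj₂ (to (shifted (suc k) rs) (i , i< , subst (λ t → entry rs i t ≡ 0) (+-suc k i) e))
    fromS : SuperdiagZero k (r ∷ rs) →
            Σ ℕ λ i → i < length (r ∷ rs) × entry (r ∷ rs) i (k + i) ≡ 0
    fromS (inj₁ e) = zero , s≤s z≤n , subst (λ t → get0 r t ≡ 0) (sym (+-identityʳ k)) e
    fromS (inj₂ z) with from (shifted (suc k) rs) z
    ... | i , i< , e = suc i , s≤s i< , subst (λ t → entry rs i t ≡ 0) (sym (+-suc k i)) e

superdiagZero-++ : ∀ k A B →
  SuperdiagZero k (A ++ B) ⇔ (SuperdiagZero k A ⊎ SuperdiagZero (k + length A) B)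
superdiagZero-++ k []      B =
  mk⇔ (inj₂ ∘ subst (λ t → SuperdiagZero t B) (sym (+-identityʳ k)))
      [ (λ ()) , subst (λ t → SuperdiagZero t B) (+-identityʳ k) ]′
superdiagZero-++ k (r ∷ A) B = begin
  (get0 r k ≡ 0 ⊎ SuperdiagZero (suc k) (A ++ B))
    ∼⟨ ⇔-id _ ⊎-⇔ superdiagZero-++ (suc k) A B ⟩
  (get0 r k ≡ 0 ⊎ (SuperdiagZero (suc k) A ⊎ SuperdiagZero (suc k + length A) B))
    ↔⟨ ⊎-assoc 0ℓ _ _ _ ⟨
  (SuperdiagZero k (r ∷ A) ⊎ SuperdiagZero (suc k + length A) B)
    ≡⟨ cong (λ t → SuperdiagZero k (r ∷ A) ⊎ SuperdiagZero t B) (sym (+-suc k (length A))) ⟩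
  (SuperdiagZero k (r ∷ A) ⊎ SuperdiagZero (k + length (r ∷ A)) B)
    ∎
  where open EquationalReasoning

superdiagZero-padRows : ∀ k M → SuperdiagZero k (padRows M) ⇔ SuperdiagZero k M
superdiagZero-padRows k []      = ⇔-id _
superdiagZero-padRows k (r ∷ M) =
  mk⇔ (trans (sym (get0-∷ʳ0 r k))) (trans (get0-∷ʳ0 r k)) ⊎-⇔ superdiagZero-padRows (suc k) M

superdiagZero-updateRow : ∀ {k y j} f M → y + k ≡ j →
  (get0 (f (getRow M y)) j ≡ 0 ⇔ get0 (getRow M y) j ≡ 0) →
  SuperdiagZero k (updateRow y f M) ⇔ SuperdiagZero k M
superdiagZero-updateRow             f []      _    _      = ⇔-id _
superdiagZero-updateRow {y = zero}  f (r ∷ M) refl entry⇔ = entry⇔ ⊎-⇔ ⇔-id _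
superdiagZero-updateRow {k} {suc y} f (r ∷ M) eq   entry⇔ =
  ⇔-id _ ⊎-⇔ superdiagZero-updateRow f M (trans (+-suc y k) eq) entry⇔

-- the shape of f_AM after reading a prefix with c ascents and last entry x
record Shape (M : Matrix) (c x : ℕ) : Set where
  field
    dim≡     : dim M ≡ suc c
    rows≡    : All (λ r → length r ≡ suc c) M
    mindex0≡ : mindex0 M ≡ x
    x≤c      : x ≤ c

  <dim : ∀ {y} → y ≤ c → y < dim M
  <dim y≤c = subst (_ <_) (sym dim≡) (s≤s y≤c)

  nonEmptyRows : All (λ r → 0 < length r) M
  nonEmptyRows = All.map (λ r≡ → subst (0 <_) (sym r≡) (s≤s z≤n)) rows≡

initial-shape : Shape ((1 ∷ []) ∷ []) 0 0
initial-shape = record { dim≡ = refl ; rows≡ = refl ∷ [] ; mindex0≡ = refl ; x≤c = z≤n }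

initial-noSuperdiagZero : ¬ SuperdiagZero 0 ((1 ∷ []) ∷ [])
initial-noSuperdiagZero (inj₁ ())
initial-noSuperdiagZero (inj₂ ())

step-am1 : ∀ {M c x y} → Shape M c x → y ≤ x → step M y ≡ updateRow y incLast M
step-am1 {M} {y = y} S y≤x with y ≟ dim M
... | yes y≡ = ⊥-elim (<⇒≢ (Shape.<dim S (≤-trans y≤x (Shape.x≤c S))) y≡)
... | no  _  with y ≤? mindex0 M
...   | yes _  = refl
...   | no  y≰ = ⊥-elim (y≰ (subst (y ≤_) (sym (Shape.mindex0≡ S)) y≤x))

step-am2 : ∀ {M c x} → Shape M c x → step M (suc c) ≡ am2 M
step-am2 {M} {c} S with suc c ≟ dim M
... | yes _       = refl
... | no  1+c≢dim = ⊥-elim (1+c≢dim (sym (Shape.dim≡ S)))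

step-am3 : ∀ {M c x y} → Shape M c x → x < y → y ≤ c → step M y ≡ am3 y M
step-am3 {M} {y = y} S x<y y≤c with y ≟ dim M
... | yes y≡ = ⊥-elim (<⇒≢ (Shape.<dim S y≤c) y≡)
... | no  _  with y ≤? mindex0 M
...   | yes y≤ = ⊥-elim (<⇒≱ (subst (_< y) (sym (Shape.mindex0≡ S)) x<y) y≤)
...   | no  _  with y <? dim M
...     | yes _  = refl
...     | no  y≮ = ⊥-elim (y≮ (Shape.<dim S y≤c))

am1-shape : ∀ {M c x y} → Shape M c x → y ≤ x → Shape (updateRow y incLast M) c y
am1-shape {M} {c} {x} {y} S y≤x = record
  { dim≡     = trans (length-updateRow y incLast M) dim≡
  ; rows≡    = All-updateRow y incLast (λ {r} r≡ → trans (length-incLast r) r≡) rows≡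
  ; mindex0≡ = mindex0-updateRow-incLast y M (subst (y ≤_) (sym mindex0≡) y≤x)
                 (<dim (≤-trans y≤x x≤c)) nonEmptyRows
  ; x≤c      = ≤-trans y≤x x≤c
  }
  where open Shape S

am1-superdiagZero : ∀ {M c x y} → Shape M c x → y ≤ x →
  SuperdiagZero 0 (updateRow y incLast M) ⇔ SuperdiagZero 0 M
am1-superdiagZero {M} {c} {x} {y} S y≤x =
  superdiagZero-updateRow incLast M (+-identityʳ y) diagonalEntry
  where
  open Shape S
  y<dim : y < dim M
  y<dim = <dim (≤-trans y≤x x≤c)
  row : List ℕ
  row = getRow M y
  row≡ : length row ≡ suc c
  row≡ = All-getRow rows≡ y<dim
  -- if y is the last column then y = x, so the entry is the non-zero last entry of the mindex row
  diagonalEntry : get0 (incLast row) y ≡ 0 ⇔ get0 row y ≡ 0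
  diagonalEntry with y <? c
  ... | yes y<c = mk⇔ (trans (sym unchanged)) (trans unchanged)
    where
    unchanged : get0 (incLast row) y ≡ get0 row y
    unchanged = get0-incLast-< row y (subst (suc y <_) (sym row≡) (s≤s y<c))
  ... | no  y≮c = mk⇔ (⊥-elim ∘ 1+n≢0 ∘ trans (sym (get0-incLast-lastIndex row y row≡′)))
                      (⊥-elim ∘ lastEntry≢0 ∘ trans (sym (get0-lastIndex row y row≡′)))
    where
    y≡c : y ≡ c
    y≡c = ≤-antisym (≤-trans y≤x x≤c) (≮⇒≥ y≮c)
    row≡′ : length row ≡ suc y
    row≡′ = trans row≡ (cong suc (sym y≡c))
    y≡mindex0 : y ≡ mindex0 M
    y≡mindex0 = trans (≤-antisym y≤x (subst (x ≤_) (sym y≡c) x≤c)) (sym mindex0≡)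
    lastEntry≢0 : lastEntry row ≢ 0
    lastEntry≢0 rewrite y≡mindex0 = mindex0-lastEntry≢0 M (subst (_< dim M) y≡mindex0 y<dim)

am2-shape : ∀ {M c x} → Shape M c x → Shape (am2 M) (suc c) (suc c)
am2-shape {M} {c} S = record
  { dim≡     = trans (length-++ (padRows M)) (trans (cong (_+ 1) padded≡) (+-comm (suc c) 1))
  ; rows≡    = AllP.++⁺ (AllP.map⁺ (All.map (λ {r} r≡ → paddedRow≡ r r≡) rows≡))
                        (trans (length-unitRow (dim M)) (cong suc dim≡) ∷ [])
  ; mindex0≡ = begin
      mindex0 (padRows M ++ [ unitRow (dim M) ])      ≡⟨ mindex0-++ (padRows M) _ paddedLastEntries ⟩
      length (padRows M) + mindex0 [ unitRow (dim M) ] ≡⟨ cong₂ _+_ padded≡ unitRow-mindex0 ⟩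
      suc c + 0                                       ≡⟨ +-identityʳ (suc c) ⟩
      suc c                                           ∎
  ; x≤c      = ≤-refl
  }
  where
  open Shape S
  open ≡-Reasoning
  padded≡ : length (padRows M) ≡ suc c
  padded≡ = trans (length-map _ M) dim≡
  paddedRow≡ : ∀ r → length r ≡ suc c → length (r ++ [ 0 ]) ≡ suc (suc c)
  paddedRow≡ r r≡ = trans (length-++ r) (trans (cong (_+ 1) r≡) (+-comm (suc c) 1))
  paddedLastEntries : All (λ r → lastEntry r ≡ 0) (padRows M)
  paddedLastEntries = AllP.map⁺ (All.universal (λ r → lastEntry-∷ʳ r 0) M)
  unitRow-mindex0 : mindex0 [ unitRow (dim M) ] ≡ 0
  unitRow-mindex0 = mindex0-∷ (unitRow (dim M)) [] (lastEntry-unitRow (dim M))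

am2-superdiagZero : ∀ M → SuperdiagZero 0 (am2 M) ⇔ SuperdiagZero 0 M
am2-superdiagZero M =
  mk⇔ ([ to (superdiagZero-padRows 0 M) , ⊥-elim ∘ newDiagonal≢0 ]′ ∘ to split)
      (from split ∘ inj₁ ∘ from (superdiagZero-padRows 0 M))
  where
  split : SuperdiagZero 0 (am2 M) ⇔
          (SuperdiagZero 0 (padRows M) ⊎ SuperdiagZero (length (padRows M)) [ unitRow (dim M) ])
  split = superdiagZero-++ 0 (padRows M) [ unitRow (dim M) ]
  newDiagonal≢0 : ¬ SuperdiagZero (length (padRows M)) [ unitRow (dim M) ]
  newDiagonal≢0 (inj₁ entry≡0) =
    1+n≢0 (trans (sym (get0-unitRow-last (dim M)))
                 (subst (λ t → get0 (unitRow (dim M)) t ≡ 0) (length-map _ M) entry≡0))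

length-am3rows : ∀ a d i M → length (am3rows a d i M) ≡ length M
length-am3rows a d i []      = refl
length-am3rows a d i (r ∷ M) with i <? a
... | yes _ = cong suc (length-am3rows a d (suc i) M)
... | no  _ = cong suc (length-am3rows a d (suc i) M)

am3rows-rows≡ : ∀ a d i {L M} → All (λ r → length r ≡ L) M →
  All (λ r → length r ≡ suc L) (am3rows a d i M)
am3rows-rows≡ a d i []                 = []
am3rows-rows≡ a d i {M = r ∷ M} (r≡ ∷ rs≡) with i <? a
... | yes _ = trans (length-take-++-∷ a r (lastEntry r) (zeroLast (drop a r))
                                     (length-zeroLast (drop a r)))
                    (cong suc r≡)
              ∷ am3rows-rows≡ a d (suc i) rs≡
... | no  _ = trans (length-take-++-∷ a r 0 (drop a r) refl) (cong suc r≡)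
              ∷ am3rows-rows≡ a d (suc i) rs≡

-- rows i < a had their last entry moved into the new column
am3rows-lastEntries : ∀ a d m i M → m + i ≤ a → All (λ r → a < length r) M →
  All (λ r → lastEntry r ≡ 0) (take m (am3rows a d i M))
am3rows-lastEntries a d zero    i M       _   _          = []
am3rows-lastEntries a d (suc m) i []      _   _          = []
am3rows-lastEntries a d (suc m) i (r ∷ M) m+i≤ (a< ∷ as<) with i <? a
... | yes _   = trans (lastEntry-++-∷ (take a r) (lastEntry r) (zeroLast (drop a r)))
                      (lastEntry-∷-zeroLast-drop a r (lastEntry r) a<)
                ∷ am3rows-lastEntries a d m (suc i) M (≤-trans (≤-reflexive (+-suc m i)) m+i≤)
                                      as<
... | no  i≮a = ⊥-elim (i≮a (≤-trans (s≤s (m≤n+m i m)) m+i≤))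

length-take-am3rows : ∀ y M → y ≤ dim M → length (take y (am3rows y (dim M) 0 M)) ≡ y
length-take-am3rows y M y≤ =
  length-take-≤ y _ (subst (y ≤_) (sym (length-am3rows y (dim M) 0 M)) y≤)

am3-shape : ∀ {M c x y} → Shape M c x → y ≤ c → Shape (am3 y M) (suc c) y
am3-shape {M} {c} {x} {y} S y≤c = record
  { dim≡     = trans (length-take-++-∷ y R new (drop y R) refl) (cong suc R≡)
  ; rows≡    = AllP.++⁺ (AllP.take⁺ y R-rows≡)
                        (trans (length-unitRow (dim M)) (cong suc dim≡) ∷ AllP.drop⁺ y R-rows≡)
  ; mindex0≡ = begin
      mindex0 (take y R ++ new ∷ drop y R)
        ≡⟨ mindex0-++ (take y R) _ upperLastEntries ⟩
      length (take y R) + mindex0 (new ∷ drop y R)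
        ≡⟨ cong₂ _+_ (length-take-am3rows y M (<⇒≤ (<dim y≤c)))
                     (mindex0-∷ new _ (lastEntry-unitRow (dim M))) ⟩
      y + 0
        ≡⟨ +-identityʳ y ⟩
      y ∎
  ; x≤c      = m≤n⇒m≤1+n y≤c
  }
  where
  open Shape S
  open ≡-Reasoning
  R : Matrix
  R = am3rows y (dim M) 0 M
  new : List ℕ
  new = unitRow (dim M)
  R≡ : length R ≡ suc c
  R≡ = trans (length-am3rows y (dim M) 0 M) dim≡
  R-rows≡ : All (λ r → length r ≡ suc (suc c)) R
  R-rows≡ = am3rows-rows≡ y (dim M) 0 rows≡
  upperLastEntries : All (λ r → lastEntry r ≡ 0) (take y R)
  upperLastEntries = am3rows-lastEntries y (dim M) y 0 M (≤-reflexive (+-identityʳ y))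
                       (All.map (λ r≡ → subst (y <_) (sym r≡) (s≤s y≤c)) rows≡)

am3-superdiagZero : ∀ {M c x y} → Shape M c x → y ≤ c → SuperdiagZero 0 (am3 y M)
am3-superdiagZero {M} {y = y} S y≤c =
  from (superdiagZero-++ 0 (take y R) (new ∷ drop y R)) (inj₂ (inj₁ newDiagonal≡0))
  where
  R : Matrix
  R = am3rows y (dim M) 0 M
  new : List ℕ
  new = unitRow (dim M)
  newDiagonal≡0 : get0 new (length (take y R)) ≡ 0
  y<dim : y < dim M
  y<dim = Shape.<dim S y≤c
  newDiagonal≡0 = subst (λ t → get0 new t ≡ 0) (sym (length-take-am3rows y M (<⇒≤ y<dim)))
                        (get0-unitRow-< y<dim)

ascBit : ℕ → ℕ → ℕ
ascBit x y with x <? y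
... | yes _ = 1
... | no  _ = 0

ascBit-< : ∀ {x y} → x < y → ascBit x y ≡ 1
ascBit-< {x} {y} x<y with x <? y
... | yes _   = refl
... | no  x≮y = ⊥-elim (x≮y x<y)

ascBit-≮ : ∀ {x y} → ¬ x < y → ascBit x y ≡ 0
ascBit-≮ {x} {y} x≮y with x <? y
... | yes x<y = ⊥-elim (x≮y x<y)
... | no  _   = refl

ascFrom-∷ : ∀ x y t → ascFrom x (y ∷ t) ≡ ascBit x y + ascFrom y t
ascFrom-∷ x y t with x <? y
... | yes _ = refl
... | no  _ = refl

+-asc-take-∷∷ : ∀ c x y r j →
  c + asc (take (suc (suc j)) (x ∷ y ∷ r)) ≡ (c + ascBit x y) + asc (take (suc j) (y ∷ r))
+-asc-take-∷∷ c x y r j =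
  trans (cong (c +_) (ascFrom-∷ x y (take j r))) (sym (+-assoc c (ascBit x y) _))

-- the bound of IsAscent on a list read after c earlier ascents
AscentBound : ℕ → List ℕ → Set
AscentBound c a = ∀ i → suc i < length a → get0 a (suc i) ≤ suc (c + asc (take (suc i) a))

HasAM3Step : ℕ → List ℕ → Set
HasAM3Step c a = Σ ℕ λ j → suc j < length a ×
  (get0 a j < get0 a (suc j) × get0 a (suc j) ≤ c + asc (take (suc j) a))

AscentBound-∷∷⇒≤ : ∀ {c x y r} → AscentBound c (x ∷ y ∷ r) → y ≤ suc c
AscentBound-∷∷⇒≤ {c} {y = y} bound =
  subst (λ t → y ≤ suc t) (+-identityʳ c) (bound 0 (s≤s (s≤s z≤n)))

AscentBound-∷∷⇒tail : ∀ {c x y r} → AscentBound c (x ∷ y ∷ r) →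
                       AscentBound (c + ascBit x y) (y ∷ r)
AscentBound-∷∷⇒tail {c} {x} {y} {r} bound i i< =
  subst (λ t → get0 r i ≤ suc t) (+-asc-take-∷∷ c x y r i) (bound (suc i) (s≤s i<))

HasAM3Step-∷∷ : ∀ c x y r →
  HasAM3Step c (x ∷ y ∷ r) ⇔ ((x < y × y ≤ c) ⊎ HasAM3Step (c + ascBit x y) (y ∷ r))
HasAM3Step-∷∷ c x y r = mk⇔ toH fromH
  where
  toH : HasAM3Step c (x ∷ y ∷ r) → (x < y × y ≤ c) ⊎ HasAM3Step (c + ascBit x y) (y ∷ r)
  toH (zero  , _      , x<y , y≤c+0) = inj₁ (x<y , subst (y ≤_) (+-identityʳ c) y≤c+0)
  toH (suc j , s≤s j< , <   , ≤    ) =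
    inj₂ (j , j< , < , subst (get0 r j ≤_) (+-asc-take-∷∷ c x y r j) ≤)
  fromH : (x < y × y ≤ c) ⊎ HasAM3Step (c + ascBit x y) (y ∷ r) → HasAM3Step c (x ∷ y ∷ r)
  fromH (inj₁ (x<y , y≤c)) =
    zero , s≤s (s≤s z≤n) , x<y , subst (y ≤_) (sym (+-identityʳ c)) y≤c
  fromH (inj₂ (j , j< , < , ≤)) =
    suc j , s≤s j< , < , subst (get0 r j ≤_) (sym (+-asc-take-∷∷ c x y r j)) ≤

⇔-⊎-refutedʳ : ∀ {A B C : Set} → ¬ B → A ⇔ C → A ⇔ (C ⊎ B)
⇔-⊎-refutedʳ ¬b A⇔C = mk⇔ (inj₁ ∘ to A⇔C) [ from A⇔C , ⊥-elim ∘ ¬b ]′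

step-shape : ∀ {M c x y} → Shape M c x → y ≤ suc c →
  Shape (step M y) (c + ascBit x y) y ×
  (SuperdiagZero 0 (step M y) ⇔ (SuperdiagZero 0 M ⊎ (x < y × y ≤ c)))
step-shape {M} {c} {x} {y} S y≤1+c with y ≤? x
... | yes y≤x rewrite step-am1 S y≤x | ascBit-≮ (≤⇒≯ y≤x) | +-identityʳ c =
  am1-shape S y≤x , ⇔-⊎-refutedʳ (λ (x<y , _) → ≤⇒≯ y≤x x<y) (am1-superdiagZero S y≤x)
... | no y≰x with y ≟ suc c
...   | yes refl rewrite step-am2 S | ascBit-< (≰⇒> y≰x) | +-comm c 1 =
  am2-shape S , ⇔-⊎-refutedʳ (λ (_ , 1+c≤c) → 1+n≰n 1+c≤c) (am2-superdiagZero M)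
...   | no y≢1+c with ≤-pred (≤∧≢⇒< y≤1+c y≢1+c)
...     | y≤c rewrite step-am3 S (≰⇒> y≰x) y≤c | ascBit-< (≰⇒> y≰x) | +-comm c 1 =
  am3-shape S y≤c , mk⇔ (λ _ → inj₂ (≰⇒> y≰x , y≤c)) (λ _ → am3-superdiagZero S y≤c)

superdiagZero-foldl-step : ∀ {M c x} r → Shape M c x → AscentBound c (x ∷ r) →
  SuperdiagZero 0 (foldl step M r) ⇔ (SuperdiagZero 0 M ⊎ HasAM3Step c (x ∷ r))
superdiagZero-foldl-step []      _ _     = mk⇔ inj₁ [ id , (λ { (_ , s≤s () , _) }) ]′
superdiagZero-foldl-step {M} {c} {x} (y ∷ r) S bound = begin
  SuperdiagZero 0 (foldl step (step M y) r)
    ∼⟨ superdiagZero-foldl-step r S′ (AscentBound-∷∷⇒tail bound) ⟩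
  (SuperdiagZero 0 (step M y) ⊎ HasAM3Step (c + ascBit x y) (y ∷ r))
    ∼⟨ step⇔ ⊎-⇔ ⇔-id _ ⟩
  ((SuperdiagZero 0 M ⊎ (x < y × y ≤ c)) ⊎ HasAM3Step (c + ascBit x y) (y ∷ r))
    ↔⟨ ⊎-assoc 0ℓ _ _ _ ⟩
  (SuperdiagZero 0 M ⊎ ((x < y × y ≤ c) ⊎ HasAM3Step (c + ascBit x y) (y ∷ r)))
    ∼⟨ ⇔-id _ ⊎-⇔ ⇔-sym (HasAM3Step-∷∷ c x y r) ⟩
  (SuperdiagZero 0 M ⊎ HasAM3Step c (x ∷ y ∷ r))
    ∎
  where
  open EquationalReasoning
  S′ : Shape (step M y) (c + ascBit x y) y
  S′ = proj₁ (step-shape S (AscentBound-∷∷⇒≤ bound))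
  step⇔ : SuperdiagZero 0 (step M y) ⇔ (SuperdiagZero 0 M ⊎ (x < y × y ≤ c))
  step⇔ = proj₂ (step-shape S (AscentBound-∷∷⇒≤ bound))

proposition3p6 : (n : ℕ) (a : List ℕ) → length a ≡ n → IsAscent a →
    HasDiagZero (fAM a) ⇔
      Σ ℕ (λ j → suc j < n × (get0 a j < get0 a (suc j) × get0 a (suc j) ≤ asc (take (suc j) a)))
proposition3p6 _ []       _    ()
proposition3p6 _ (_ ∷ xs) refl (refl , bound) = begin
  HasDiagZero (fAM (0 ∷ xs))
    ∼⟨ HasDiagZero⇔SuperdiagZero _ ⟩
  SuperdiagZero 0 (foldl step M₁ xs)
    ∼⟨ superdiagZero-foldl-step xs initial-shape bound ⟩
  (SuperdiagZero 0 M₁ ⊎ HasAM3Step 0 (0 ∷ xs))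
    ∼⟨ mk⇔ [ ⊥-elim ∘ initial-noSuperdiagZero , id ]′ inj₂ ⟩
  HasAM3Step 0 (0 ∷ xs)
    ∎
  where
  open EquationalReasoning
  M₁ : Matrix
  M₁ = (1 ∷ []) ∷ []
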